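{- Let $w$ be a fundamental outcome of degree $d$ with $\#\mathrm{supp}^+(w)=n+1$. Then $n\leq d$.
   Context: $V_d=\{(i,j)\in\mathbb Z_{\geq0}^2\mid i+j\leq d\}$. A chip configuration is $w\in\mathbb Z^{V_d}$; a splitting move at $p\in V_{d-1}$ decreases $w_p$ by $1$ and increases $w_{p+(1,0)}$, $w_{p+(0,1)}$ by $1$, an unsplitting move is its inverse, and an outcome is a configuration reachable from the zero configuration by finitely many moves. $\mathrm{supp}^+(w)=\{(i,j)\mid w_{i,j}>0\}$, $\deg(w)=\max\{i+j\mid w_{i,j}\neq0\}$; $w$ is valid if $w_{i,j}\geq0$ for all $(i,j)\neq(0,0)$. A valid outcome $w\neq 0$ is fundamental if it cannot be written as $w=\mu_1w_1+\mu_2w_2$ with $\mu_1,\mu_2\in\mathbb Q_{>0}$ and valid outcomes $w_1,w_2\in\mathbb Z^{V_d}$ satisfying $\mathrm{supp}^+(w_1),\mathrm{supp}^+(w_2)\subsetneq\mathrm{supp}^+(w)$. -}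

module Defs where

open import Data.Nat as ℕ using (ℕ; zero; suc)
open import Data.Integer as ℤ using (ℤ; +_)
open import Data.Rational as ℚ using (ℚ; 0ℚ)
open import Data.Bool using (Bool; true; false)
open import Data.Product using (Σ; ∃; _×_; _,_; ∃-syntax)
open import Data.List using (List; []; _∷_; length)
open import Data.List.Relation.Unary.All using (All)
open import Data.List.Relation.Unary.Unique.Propositional using (Unique)
open import Data.List.Membership.Propositional using (_∈_)
open import Relation.Binary.PropositionalEquality using (_≡_)
open import Relation.Nullary using (¬_; yes; no)
open import Function.Bundles using (_⇔_)

-- A chip configuration on V_D: a function ℕ × ℕ → ℤ (entries outside V_D are
-- irrelevant; outcomes are automatically zero outside V_D).
Config : Set
Config = ℕ → ℕ → ℤ

δ : ℕ → ℕ → ℕ → ℕ → ℤ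
δ a b i j with i ℕ.≟ a | j ℕ.≟ b
... | yes _ | yes _ = + 1
... | _     | _     = + 0

splitEffect : ℕ → ℕ → Config
splitEffect a b i j = (δ (suc a) b i j ℤ.+ δ a (suc b) i j) ℤ.- δ a b i j

Move : Set
Move = ℕ × ℕ × Bool

moveEffect : Move → Config
moveEffect (a , b , true)  i j = splitEffect a b i j
moveEffect (a , b , false) i j = ℤ.- splitEffect a b i j

applyMoves : List Move → Config
applyMoves []       i j = + 0
applyMoves (m ∷ ms) i j = applyMoves ms i j ℤ.+ moveEffect m i j

MoveIn : ℕ → Move → Set
MoveIn D (a , b , _) = a ℕ.+ b ℕ.< D

Outcome : ℕ → Config → Set
Outcome D w = ∃[ ms ] (All (MoveIn D) ms × (∀ i j → w i j ≡ applyMoves ms i j))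

Valid : Config → Set
Valid w = ∀ i j → ¬ (i ≡ 0 × j ≡ 0) → + 0 ℤ.≤ w i j

IsZero : Config → Set
IsZero w = ∀ i j → w i j ≡ + 0

SuppStrictSub : Config → Config → Set
SuppStrictSub u w =
  (∀ i j → + 0 ℤ.< u i j → + 0 ℤ.< w i j) ×
  (∃[ i ] ∃[ j ] (+ 0 ℤ.< w i j × ¬ (+ 0 ℤ.< u i j)))

toℚ : ℤ → ℚ
toℚ z = z ℚ./ 1

Fundamental : ℕ → Config → Set
Fundamental D w =
  Valid w × Outcome D w × ¬ IsZero w ×
  ¬ (Σ ℚ λ μ₁ → Σ ℚ λ μ₂ → Σ Config λ w₁ → Σ Config λ w₂ →
       0ℚ ℚ.< μ₁ × 0ℚ ℚ.< μ₂ ×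
       Valid w₁ × Outcome D w₁ × Valid w₂ × Outcome D w₂ ×
       SuppStrictSub w₁ w × SuppStrictSub w₂ w ×
       (∀ i j → toℚ (w i j) ≡ μ₁ ℚ.* toℚ (w₁ i j) ℚ.+ μ₂ ℚ.* toℚ (w₂ i j)))

Degree : Config → ℕ → Set
Degree w d =
  (∃[ i ] ∃[ j ] (i ℕ.+ j ≡ d × ¬ (w i j ≡ + 0))) ×
  (∀ i j → ¬ (w i j ≡ + 0) → i ℕ.+ j ℕ.≤ d)

SuppCard : Config → ℕ → Set
SuppCard w k = ∃[ L ] (Unique L × length L ≡ k ×
                       (∀ i j → ((i , j) ∈ L) ⇔ (+ 0 ℤ.< w i j)))

module Submission where

-- Every outcome w on V_D satisfies ∑ w(i,j) 2^(D-i-j) = 0, since a split at (a,b) trades the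
-- weight 2^(D-a-b) for two halves. Hence a valid outcome is nonpositive at the origin, and the
-- positive support L of w lies in V_d ∖ {(0,0)}. If #L = n + 1 > d + 1, asking an integer
-- combination U of the #V_(d-1) splits at points of V_(d-1) to vanish at one point p of L and
-- at every point of V_d outside L ∪ {(0,0)} imposes fewer than #V_(d-1) linear conditions, so a
-- nontrivial U exists, and U ≠ 0 because distinct splits are independent. Pushing w along U
-- until some coordinate in L reaches zero, once in each direction, writes a positive multiple
-- of w as a sum of two valid outcomes with strictly smaller positive supports.

open import Defs
open import Data.Nat as ℕ using (ℕ; zero; suc; s≤s; z≤n; _≤_; _<_; _^_; _∸_)
import Data.Nat.Properties as ℕP
open import Data.Integer as ℤ using (ℤ; +_; -[1+_]; +[1+_]; _+_; _*_; _-_; -_; 0ℤ; 1ℤ)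
import Data.Integer.Properties as ℤP
open import Data.Integer.Solver using (module +-*-Solver)
open +-*-Solver using (solve; _:+_; _:*_; :-_; _:-_; _:=_; con)
open import Data.Rational as ℚ using (0ℚ; toℚᵘ)
import Data.Rational.Properties as ℚP
open import Data.Rational.Unnormalised as ℚᵘ using (ℚᵘ; mkℚᵘ; *≡*) renaming (_≃_ to _≃ᵘ_)
import Data.Rational.Unnormalised.Properties as ℚᵘP
open import Data.Fin using (Fin; zero; suc; punchIn)
import Data.Fin.Properties as FinP
open import Data.Vec.Functional using (Vector; insertAt)
open import Data.Vec.Functional.Properties using (insertAt-lookup; insertAt-punchIn)
open import Data.List using (List; []; _∷_; length; _++_; map; lookup; filter; allFin)
open import Data.List.Properties using (length-++; length-map)
open import Data.List.Membership.Propositional using (_∈_; _∉_)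
open import Data.List.Membership.Propositional.Properties
  using (∈-++⁻; ∈-++⁺ˡ; ∈-++⁺ʳ; ∈-lookup; ∈-filter⁺; ∈-filter⁻; ∈-allFin)
import Data.List.Extrema
import Data.List.Extrema.Nat as ℕExtrema
open import Data.List.Relation.Binary.Subset.Propositional using (_⊆_)
open import Data.List.Relation.Unary.Any using (here; there; index)
open import Data.List.Relation.Unary.Any.Properties using (lookup-index)
open import Data.List.Relation.Unary.All as All using (All; []; _∷_)
import Data.List.Relation.Unary.All.Properties as AllP
open import Data.List.Relation.Unary.Unique.Propositional using (Unique)
import Data.List.Relation.Unary.Unique.Propositional.Properties as Unique
open import Data.List.Relation.Unary.AllPairs using ([]; _∷_)
open import Data.Product using (∃-syntax; _×_; _,_; proj₁; proj₂)
open import Data.Product.Properties using (≡-dec)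
open import Data.Sum using (_⊎_; inj₁; inj₂; [_,_]′)
open import Data.Empty using (⊥-elim)
open import Data.Bool using (true; false; not)
open import Relation.Nullary using (¬_; yes; no; ¬?)
open import Relation.Nullary.Decidable using (decidable-stable; _×-dec_)
open import Relation.Unary using (Decidable)
open import Relation.Binary.Definitions using (DecidableEquality)
open import Relation.Binary.PropositionalEquality
open import Function using (_∘_; _⇔_; Equivalence)

open import Algebra.Properties.Semiring.Sum ℤP.+-*-semiring
  using (sum; sum-syntax; sum-cong-≗; ∑-distrib-+; *-distribˡ-sum; sum-remove; sum-replicate-zero)

sum-zero : ∀ {k} (f : Vector ℤ k) → (∀ t → f t ≡ 0ℤ) → sum f ≡ 0ℤ
sum-zero {k} f f≗0 = trans (sum-cong-≗ f≗0) (sum-replicate-zero k)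

sum-single : ∀ {k} (f : Vector ℤ k) (s : Fin k) → (∀ t → t ≢ s → f t ≡ 0ℤ) → sum f ≡ f s
sum-single {suc k} f s others = begin
  sum f                             ≡⟨ sum-remove {i = s} f ⟩
  f s + sum (λ t → f (punchIn s t)) ≡⟨ cong (_+_ (f s)) (sum-zero _ (λ t → others _ (FinP.punchInᵢ≢i s t))) ⟩
  f s + 0ℤ                          ≡⟨ ℤP.+-identityʳ (f s) ⟩
  f s                               ∎
  where open ≡-Reasoning

sum-nonneg : ∀ {k} (f : Vector ℤ k) → (∀ t → + 0 ℤ.≤ f t) → + 0 ℤ.≤ sum f
sum-nonneg {zero}  f _   = ℤP.≤-refl
sum-nonneg {suc k} f f≥0 = ℤP.+-mono-≤ (f≥0 zero) (sum-nonneg (f ∘ suc) (f≥0 ∘ suc))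

sum-pos : ∀ {k} (f : Vector ℤ (suc k)) → (∀ t → + 0 ℤ.≤ f t) → ∀ s → + 0 ℤ.< f s → + 0 ℤ.< sum f
sum-pos f f≥0 s f[s]>0 = subst (+ 0 ℤ.<_) (sym (sum-remove {i = s} f))
  (ℤP.+-mono-<-≤ f[s]>0 (sum-nonneg (f ∘ punchIn s) (f≥0 ∘ punchIn s)))

*-nonneg : ∀ {a b} → + 0 ℤ.≤ a → + 0 ℤ.≤ b → + 0 ℤ.≤ a * b
*-nonneg {b = b} a≥0 b≥0 = ℤP.*-monoʳ-≤-nonNeg b {{ℤ.nonNegative b≥0}} a≥0

*-pos : ∀ {a b} → + 0 ℤ.< a → + 0 ℤ.< b → + 0 ℤ.< a * b
*-pos {b = b} a>0 b>0 = ℤP.*-monoʳ-<-pos b {{ℤ.positive b>0}} a>0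

*-≢0 : ∀ {a b} → a ≢ 0ℤ → b ≢ 0ℤ → a * b ≢ 0ℤ
*-≢0 {a} a≢0 b≢0 ab≡0 = [ a≢0 , b≢0 ]′ (ℤP.i*j≡0⇒i≡0∨j≡0 a ab≡0)

pos-of-*-≤ : ∀ {a b c d} → + 0 ℤ.< a * b → a * b ℤ.≤ c * d → + 0 ℤ.≤ d → + 0 ℤ.< c
pos-of-*-≤ {d = d} ab>0 ab≤cd d≥0 =
  ℤP.*-cancelʳ-<-nonNeg d {{ℤ.nonNegative d≥0}} (ℤP.<-≤-trans ab>0 ab≤cd)

-- Homogeneous linear systems

_·_ : ∀ {k} → Vector ℤ k → Vector ℤ k → ℤ
_·_ {k} e x = ∑[ t < k ] (e t * x t)

NonTrivial : ∀ {k} → Vector ℤ k → Set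
NonTrivial x = ∃[ t ] x t ≢ 0ℤ

NontrivialSolution : ∀ {k} → List (Vector ℤ k) → Set
NontrivialSolution E = ∃[ x ] NonTrivial x × All (λ e → e · x ≡ 0ℤ) E

·-insertAt : ∀ {k} (f : Vector ℤ (suc k)) r (y : Vector ℤ k) v →
  f · insertAt y r v ≡ f r * v + (f ∘ punchIn r) · y
·-insertAt f r y v = trans (sum-remove {i = r} (λ t → f t * insertAt y r v t))
  (cong₂ _+_ (cong (f r *_) (insertAt-lookup y r v))
             (sum-cong-≗ (λ t → cong (f (punchIn r t) *_) (insertAt-punchIn y r v t))))

·-scaleʳ : ∀ {k} (f y : Vector ℤ k) c → f · (λ t → c * y t) ≡ c * (f · y)
·-scaleʳ {k} f y c = begin
  ∑[ t < k ] (f t * (c * y t)) ≡⟨ sum-cong-≗ (λ t → solve 3 (λ a b d → a :* (b :* d) := b :* (a :* d)) refl (f t) c (y t)) ⟩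
  ∑[ t < k ] (c * (f t * y t)) ≡⟨ *-distribˡ-sum c (λ t → f t * y t) ⟨
  c * (f · y)                  ∎
  where open ≡-Reasoning

·-linearˡ : ∀ {k} (f g y : Vector ℤ k) a b → (λ t → a * f t - b * g t) · y ≡ a * (f · y) - b * (g · y)
·-linearˡ {k} f g y a b = begin
  ∑[ t < k ] ((a * f t - b * g t) * y t)
    ≡⟨ sum-cong-≗ (λ t → solve 5 (λ a b f g y → (a :* f :- b :* g) :* y := a :* (f :* y) :+ (:- b) :* (g :* y))
                                 refl a b (f t) (g t) (y t)) ⟩
  ∑[ t < k ] (a * (f t * y t) + - b * (g t * y t))
    ≡⟨ ∑-distrib-+ (λ t → a * (f t * y t)) (λ t → - b * (g t * y t)) ⟩
  ∑[ t < k ] (a * (f t * y t)) + ∑[ t < k ] (- b * (g t * y t))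
    ≡⟨ cong₂ _+_ (*-distribˡ-sum a (λ t → f t * y t)) (*-distribˡ-sum (- b) (λ t → g t * y t)) ⟨
  a * (f · y) + - b * (g · y)
    ≡⟨ cong (_+_ (a * (f · y))) (ℤP.neg-distribˡ-* b (g · y)) ⟨
  a * (f · y) - b * (g · y) ∎
  where open ≡-Reasoning

-- Gaussian elimination of the r-th unknown, with pivot e r.
module Pivot {k} (e : Vector ℤ (suc k)) (r : Fin (suc k)) where

  restrict : Vector ℤ (suc k) → Vector ℤ k
  restrict f = f ∘ punchIn r

  reduce : Vector ℤ (suc k) → Vector ℤ k
  reduce f t = e r * restrict f t - f r * restrict e t

  lift : Vector ℤ k → Vector ℤ (suc k)
  lift y = insertAt (λ t → e r * y t) r (- (restrict e · y))

  ·-lift : ∀ f y → f · lift y ≡ reduce f · y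
  ·-lift f y = begin
    f · lift y                                              ≡⟨ ·-insertAt f r _ _ ⟩
    f r * - (restrict e · y) + restrict f · (λ t → e r * y t) ≡⟨ cong (_+_ (f r * - (restrict e · y))) (·-scaleʳ (restrict f) y (e r)) ⟩
    f r * - (restrict e · y) + e r * (restrict f · y)       ≡⟨ solve 4 (λ a b c d → a :* (:- b) :+ c :* d := c :* d :- a :* b)
                                                                       refl (f r) (restrict e · y) (e r) (restrict f · y) ⟩
    e r * (restrict f · y) - f r * (restrict e · y)         ≡⟨ ·-linearˡ (restrict f) (restrict e) y (e r) (f r) ⟨
    reduce f · y                                            ∎
    where open ≡-Reasoning

  lift-solves-pivot : ∀ y → e · lift y ≡ 0ℤ
  lift-solves-pivot y = trans (·-lift e y)
    (trans (·-linearˡ (restrict e) (restrict e) y (e r) (e r)) (ℤP.+-inverseʳ (e r * (restrict e · y))))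

  lift-nonTrivial : e r ≢ 0ℤ → ∀ {y} → NonTrivial y → NonTrivial (lift y)
  lift-nonTrivial e[r]≢0 (t , y[t]≢0) = punchIn r t , λ eq →
    *-≢0 e[r]≢0 y[t]≢0 (trans (sym (insertAt-punchIn _ r _ t)) eq)

nonzero-entry? : ∀ {k} (e : Vector ℤ k) → (∃[ r ] e r ≢ 0ℤ) ⊎ (∀ t → e t ≡ 0ℤ)
nonzero-entry? {k} e with FinP.all? (λ t → e t ℤ.≟ 0ℤ)
... | yes e≗0  = inj₂ e≗0
... | no ¬e≗0 = inj₁ (FinP.¬∀⟶∃¬ k _ (λ t → e t ℤ.≟ 0ℤ) ¬e≗0)

nontrivialSolution-∷-zero : ∀ {k} {e : Vector ℤ k} {E} → (∀ t → e t ≡ 0ℤ) →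
  NontrivialSolution E → NontrivialSolution (e ∷ E)
nontrivialSolution-∷-zero e≗0 (x , x≢0 , x-solves) =
  x , x≢0 , sum-zero _ (λ t → trans (cong (_* x t) (e≗0 t)) (ℤP.*-zeroˡ (x t))) ∷ x-solves

nontrivialSolution-∷-pivot : ∀ {k} {e : Vector ℤ (suc k)} {r E} → e r ≢ 0ℤ →
  NontrivialSolution (map (Pivot.reduce e r) E) → NontrivialSolution (e ∷ E)
nontrivialSolution-∷-pivot {e = e} {r} e[r]≢0 (y , y≢0 , y-solves) =
  lift y , lift-nonTrivial e[r]≢0 y≢0 ,
  lift-solves-pivot y ∷ All.map (λ {f} → trans (·-lift f y)) (AllP.map⁻ y-solves)
  where open Pivot e r

homogeneous-solution : ∀ {k} (E : List (Vector ℤ k)) → length E < k → NontrivialSolution E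
homogeneous-solution {suc k} []      _            = (λ _ → 1ℤ) , (zero , λ ()) , []
homogeneous-solution {suc k} (e ∷ E) (s≤s |E|<k) =
  [ (λ (r , e[r]≢0) → nontrivialSolution-∷-pivot e[r]≢0
        (homogeneous-solution (map (Pivot.reduce e r) E) (subst (_< k) (sym (length-map _ E)) |E|<k)))
  , (λ e≗0 → nontrivialSolution-∷-zero e≗0 (homogeneous-solution E (ℕP.m<n⇒m<1+n |E|<k)))
  ]′ (nonzero-entry? e)

private variable
  A : Set
  xs ys : List A

lookup-injective : Unique xs → ∀ {s t} → lookup xs s ≡ lookup xs t → s ≡ t
lookup-injective (_ ∷ _)         {zero}  {zero}  _  = refl
lookup-injective (x∉xs ∷ _)      {zero}  {suc t} eq = ⊥-elim (All.lookup x∉xs (∈-lookup t) eq)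
lookup-injective (x∉xs ∷ _)      {suc s} {zero}  eq = ⊥-elim (All.lookup x∉xs (∈-lookup s) (sym eq))
lookup-injective (_ ∷ xs-unique) {suc s} {suc t} eq = cong suc (lookup-injective xs-unique eq)

Unique-⊆⇒length≤ : Unique xs → xs ⊆ ys → length xs ≤ length ys
Unique-⊆⇒length≤ {xs = xs} {ys} xs-unique xs⊆ys = FinP.injective⇒≤ {f = position} position-injective
  where
  position : Fin (length xs) → Fin (length ys)
  position t = index (xs⊆ys (∈-lookup t))
  lookup-position : ∀ t → lookup xs t ≡ lookup ys (position t)
  lookup-position t = lookup-index (xs⊆ys (∈-lookup t))
  position-injective : ∀ {s t} → position s ≡ position t → s ≡ t
  position-injective {s} {t} eq = lookup-injective xs-unique
    (trans (lookup-position s) (trans (cong (lookup ys) eq) (sym (lookup-position t))))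

∈-of-length≡suc : ∀ {n} → length xs ≡ suc n → ∃[ x ] x ∈ xs
∈-of-length≡suc {xs = x ∷ _} _ = x , here refl

∑ₗ : List A → (A → ℤ) → ℤ
∑ₗ E f = ∑[ t < length E ] f (lookup E t)

∑ₗ-single : ∀ {E : List A} {p} (f : A → ℤ) → Unique E → p ∈ E → (∀ q → q ≢ p → f q ≡ 0ℤ) → ∑ₗ E f ≡ f p
∑ₗ-single {E = E} f E-unique p∈E f-vanishes =
  trans (sum-single (f ∘ lookup E) (index p∈E)
          (λ t t≢ → f-vanishes _ (λ eq → t≢ (lookup-injective E-unique (trans eq (lookup-index p∈E))))))
        (cong f (sym (lookup-index p∈E)))

∑ₗ-pos : ∀ {E : List A} {p} (f : A → ℤ) → (∀ {q} → q ∈ E → + 0 ℤ.≤ f q) → p ∈ E → + 0 ℤ.< f p →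
  + 0 ℤ.< ∑ₗ E f
∑ₗ-pos {E = E@(_ ∷ _)} f f≥0 p∈E f[p]>0 =
  sum-pos (f ∘ lookup E) (f≥0 ∘ ∈-lookup) (index p∈E) (subst (λ q → + 0 ℤ.< f q) (lookup-index p∈E) f[p]>0)

-- The triangles V_(n-1) = {(i , j) | i + j < n}

Point : Set
Point = ℕ × ℕ

deg : Point → ℕ
deg (i , j) = i ℕ.+ j

_≟ₚ_ : DecidableEquality Point
_≟ₚ_ = ≡-dec ℕ._≟_ ℕ._≟_

open import Data.List.Membership.DecPropositional _≟ₚ_ using (_∈?_)

diagonal : ℕ → ℕ → List Point
diagonal zero    b = (0 , b) ∷ []
diagonal (suc a) b = (suc a , b) ∷ diagonal a (suc b)

triangle : ℕ → List Point
triangle zero    = []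
triangle (suc n) = triangle n ++ diagonal n 0

∈-diagonal⁻ : ∀ a b {q} → q ∈ diagonal a b → deg q ≡ a ℕ.+ b × proj₁ q ≤ a
∈-diagonal⁻ zero    b (here refl) = refl , z≤n
∈-diagonal⁻ (suc a) b (here refl) = refl , ℕP.≤-refl
∈-diagonal⁻ (suc a) b (there q∈) =
  let deg≡ , i≤a = ∈-diagonal⁻ a (suc b) q∈ in trans deg≡ (ℕP.+-suc a b) , ℕP.m≤n⇒m≤1+n i≤a

∈-diagonal⁺ : ∀ a b {i j} → i ℕ.+ j ≡ a ℕ.+ b → i ≤ a → (i , j) ∈ diagonal a b
∈-diagonal⁺ zero    b {zero} j≡b z≤n = here (cong (0 ,_) j≡b)
∈-diagonal⁺ (suc a) b {i} {j} deg≡ i≤1+a with i ℕ.≟ suc a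
... | yes refl = here (cong (suc a ,_) (ℕP.+-cancelˡ-≡ (suc a) j b deg≡))
... | no i≢1+a = there (∈-diagonal⁺ a (suc b) (trans deg≡ (sym (ℕP.+-suc a b))) (ℕP.≤-pred (ℕP.≤∧≢⇒< i≤1+a i≢1+a)))

diagonal-unique : ∀ a b → Unique (diagonal a b)
diagonal-unique zero    b = [] ∷ []
diagonal-unique (suc a) b =
  All.tabulate (λ q∈ eq → ℕP.1+n≰n (subst (λ q → proj₁ q ≤ a) (sym eq) (proj₂ (∈-diagonal⁻ a (suc b) q∈))))
  ∷ diagonal-unique a (suc b)

length-diagonal : ∀ a b → length (diagonal a b) ≡ suc a
length-diagonal zero    b = refl
length-diagonal (suc a) b = cong suc (length-diagonal a (suc b))

∈-triangle⁻ : ∀ n {q} → q ∈ triangle n → deg q < n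
∈-triangle⁻ (suc n) q∈ with ∈-++⁻ (triangle n) q∈
... | inj₁ q∈triangle = ℕP.m<n⇒m<1+n (∈-triangle⁻ n q∈triangle)
... | inj₂ q∈diagonal = s≤s (ℕP.≤-reflexive (trans (proj₁ (∈-diagonal⁻ n 0 q∈diagonal)) (ℕP.+-identityʳ n)))

∈-triangle⁺ : ∀ n {i j} → i ℕ.+ j < n → (i , j) ∈ triangle n
∈-triangle⁺ (suc n) {i} (s≤s i+j≤n) with ℕP.m≤n⇒m<n∨m≡n i+j≤n
... | inj₁ i+j<n = ∈-++⁺ˡ (∈-triangle⁺ n i+j<n)
... | inj₂ i+j≡n = ∈-++⁺ʳ (triangle n)
                     (∈-diagonal⁺ n 0 (trans i+j≡n (sym (ℕP.+-identityʳ n))) (ℕP.m+n≤o⇒m≤o i i+j≤n))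

triangle-unique : ∀ n → Unique (triangle n)
triangle-unique zero    = []
triangle-unique (suc n) = Unique.++⁺ (triangle-unique n) (diagonal-unique n 0)
  (λ (q∈triangle , q∈diagonal) →
     ℕP.<-irrefl (trans (proj₁ (∈-diagonal⁻ n 0 q∈diagonal)) (ℕP.+-identityʳ n)) (∈-triangle⁻ n q∈triangle))

length-triangle : ∀ n → length (triangle (suc n)) ≡ length (triangle n) ℕ.+ suc n
length-triangle n = trans (length-++ (triangle n)) (cong (length (triangle n) ℕ.+_) (length-diagonal n 0))

_⟨_⟩ : Config → Point → ℤ
u ⟨ q ⟩ = u (proj₁ q) (proj₂ q)

_≗₂_ : Config → Config → Set
u ≗₂ v = ∀ i j → u i j ≡ v i j

split : Point → Config
split (a , b) = splitEffect a b

δ-same : ∀ a b → δ a b a b ≡ 1ℤ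
δ-same a b with a ℕ.≟ a | b ℕ.≟ b
... | yes _  | yes _  = refl
... | no a≢a | _      = ⊥-elim (a≢a refl)
... | yes _  | no b≢b = ⊥-elim (b≢b refl)

δ-≢ : ∀ {a b i j} → (a , b) ≢ (i , j) → δ a b i j ≡ 0ℤ
δ-≢ {a} {b} {i} {j} ab≢ij with i ℕ.≟ a | j ℕ.≟ b
... | yes refl | yes refl = ⊥-elim (ab≢ij refl)
... | yes _    | no _     = refl
... | no _     | yes _    = refl
... | no _     | no _     = refl

flipMove : Move → Move
flipMove (a , b , s) = a , b , not s

moveEffect-flip : ∀ m i j → moveEffect (flipMove m) i j ≡ - moveEffect m i j
moveEffect-flip (a , b , true)  i j = refl
moveEffect-flip (a , b , false) i j = sym (ℤP.neg-involutive _)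

applyMoves-++ : ∀ ms ms′ i j → applyMoves (ms ++ ms′) i j ≡ applyMoves ms i j + applyMoves ms′ i j
applyMoves-++ []       ms′ i j = sym (ℤP.+-identityˡ _)
applyMoves-++ (m ∷ ms) ms′ i j rewrite applyMoves-++ ms ms′ i j =
  solve 3 (λ x y z → (x :+ y) :+ z := (x :+ z) :+ y) refl (applyMoves ms i j) (applyMoves ms′ i j) (moveEffect m i j)

applyMoves-flip : ∀ ms i j → applyMoves (map flipMove ms) i j ≡ - applyMoves ms i j
applyMoves-flip []       i j = refl
applyMoves-flip (m ∷ ms) i j rewrite applyMoves-flip ms i j | moveEffect-flip m i j =
  sym (ℤP.neg-distrib-+ (applyMoves ms i j) (moveEffect m i j))

module _ {D : ℕ} where

  Outcome-resp : ∀ {u v} → u ≗₂ v → Outcome D v → Outcome D u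
  Outcome-resp u≗v (ms , ms∈ , v≗ms) = ms , ms∈ , λ i j → trans (u≗v i j) (v≗ms i j)

  Outcome-zero : Outcome D (λ _ _ → 0ℤ)
  Outcome-zero = [] , [] , λ _ _ → refl

  Outcome-+ : ∀ {u v} → Outcome D u → Outcome D v → Outcome D (λ i j → u i j + v i j)
  Outcome-+ (ms , ms∈ , u≗ms) (ms′ , ms′∈ , v≗ms′) =
    ms ++ ms′ , AllP.++⁺ ms∈ ms′∈ ,
    λ i j → trans (cong₂ _+_ (u≗ms i j) (v≗ms′ i j)) (sym (applyMoves-++ ms ms′ i j))

  Outcome-neg : ∀ {u} → Outcome D u → Outcome D (λ i j → - u i j)
  Outcome-neg (ms , ms∈ , u≗ms) =
    map flipMove ms , AllP.map⁺ (All.map (λ {m} → flipMove-in m) ms∈) ,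
    λ i j → trans (cong -_ (u≗ms i j)) (sym (applyMoves-flip ms i j))
    where
    flipMove-in : ∀ m → MoveIn D m → MoveIn D (flipMove m)
    flipMove-in (a , b , s) a+b<D = a+b<D

  Outcome-scaleℕ : ∀ n {u} → Outcome D u → Outcome D (λ i j → + n * u i j)
  Outcome-scaleℕ zero    {u} _ = Outcome-resp (λ i j → ℤP.*-zeroˡ (u i j)) Outcome-zero
  Outcome-scaleℕ (suc n) {u} o = Outcome-resp (λ i j → ℤP.suc-* (+ n) (u i j)) (Outcome-+ o (Outcome-scaleℕ n o))

  Outcome-scale : ∀ z {u} → Outcome D u → Outcome D (λ i j → z * u i j)
  Outcome-scale (+ n)        o = Outcome-scaleℕ n o
  Outcome-scale -[1+ n ] {u} o =
    Outcome-resp (λ i j → sym (ℤP.neg-distribˡ-* +[1+ n ] (u i j))) (Outcome-neg (Outcome-scaleℕ (suc n) o))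

  Outcome-split : ∀ p → deg p < D → Outcome D (split p)
  Outcome-split (a , b) a+b<D = (a , b , true) ∷ [] , a+b<D ∷ [] , λ i j → sym (ℤP.+-identityˡ _)

split-vanishes : ∀ {B} p {i j} → deg p < B → B < i ℕ.+ j → split p i j ≡ 0ℤ
split-vanishes {B} (a , b) {i} {j} a+b<B B<i+j =
  cong₂ _-_ (cong₂ _+_ (δ-≢ (below a+b<B)) (δ-≢ (below (subst (_≤ B) (sym (ℕP.+-suc a b)) a+b<B))))
            (δ-≢ (below (ℕP.<⇒≤ a+b<B)))
  where
  below : ∀ {q} → deg q ≤ B → q ≢ (i , j)
  below deg≤B refl = ℕP.<-irrefl refl (ℕP.≤-<-trans deg≤B B<i+j)

applyMoves-vanishes : ∀ {D ms i j} → All (MoveIn D) ms → D < i ℕ.+ j → applyMoves ms i j ≡ 0ℤ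
applyMoves-vanishes [] _ = refl
applyMoves-vanishes {ms = (a , b , true) ∷ _} {i} {j} (a+b<D ∷ ms∈) D<i+j =
  cong₂ _+_ (applyMoves-vanishes ms∈ D<i+j) (split-vanishes (a , b) {i} {j} a+b<D D<i+j)
applyMoves-vanishes {ms = (a , b , false) ∷ _} {i} {j} (a+b<D ∷ ms∈) D<i+j =
  cong₂ _+_ (applyMoves-vanishes ms∈ D<i+j) (cong -_ (split-vanishes (a , b) {i} {j} a+b<D D<i+j))

Outcome-vanishes : ∀ {D u i j} → Outcome D u → D < i ℕ.+ j → u i j ≡ 0ℤ
Outcome-vanishes {i = i} {j} (ms , ms∈ , u≗ms) D<i+j = trans (u≗ms i j) (applyMoves-vanishes ms∈ D<i+j)

-- The weighted chip count

module Invariant (D : ℕ) where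

  -- only ever evaluated on V_D, where the subtraction does not truncate
  weight : Point → ℤ
  weight q = + (2 ^ (D ∸ deg q))

  weighted : Config → Point → ℤ
  weighted u q = u ⟨ q ⟩ * weight q

  invariant : Config → ℤ
  invariant u = ∑ₗ (triangle (suc D)) (weighted u)

  private
    E = triangle (suc D)

    ∑ₗ-cong : ∀ {f g : Point → ℤ} → (∀ q → f q ≡ g q) → ∑ₗ E f ≡ ∑ₗ E g
    ∑ₗ-cong f≗g = sum-cong-≗ (f≗g ∘ lookup E)

  invariant-resp : ∀ {u v} → u ≗₂ v → invariant u ≡ invariant v
  invariant-resp u≗v = ∑ₗ-cong (λ q → cong (_* weight q) (u≗v (proj₁ q) (proj₂ q)))

  invariant-zero : invariant (λ _ _ → 0ℤ) ≡ 0ℤ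
  invariant-zero = sum-zero _ (λ t → ℤP.*-zeroˡ (weight (lookup E t)))

  invariant-+ : ∀ u v → invariant (λ i j → u i j + v i j) ≡ invariant u + invariant v
  invariant-+ u v = trans (∑ₗ-cong (λ q → ℤP.*-distribʳ-+ (weight q) (u ⟨ q ⟩) (v ⟨ q ⟩)))
                          (∑-distrib-+ (weighted u ∘ lookup E) (weighted v ∘ lookup E))

  invariant-neg : ∀ u → invariant (λ i j → - u i j) ≡ - invariant u
  invariant-neg u = begin
    invariant (λ i j → - u i j)
      ≡⟨ ∑ₗ-cong (λ q → trans (sym (ℤP.neg-distribˡ-* (u ⟨ q ⟩) (weight q))) (sym (ℤP.-1*i≡-i _))) ⟩
    ∑ₗ E (λ q → ℤ.-1ℤ * weighted u q)
      ≡⟨ *-distribˡ-sum ℤ.-1ℤ (weighted u ∘ lookup E) ⟨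
    ℤ.-1ℤ * invariant u
      ≡⟨ ℤP.-1*i≡-i _ ⟩
    - invariant u ∎
    where open ≡-Reasoning

  invariant-δ : ∀ a b → a ℕ.+ b ≤ D → invariant (δ a b) ≡ weight (a , b)
  invariant-δ a b a+b≤D =
    trans (∑ₗ-single (weighted (δ a b)) (triangle-unique (suc D)) (∈-triangle⁺ (suc D) (s≤s a+b≤D))
            (λ q q≢ab → trans (cong (_* weight q) (δ-≢ (q≢ab ∘ sym))) (ℤP.*-zeroˡ (weight q))))
          (trans (cong (_* weight (a , b)) (δ-same a b)) (ℤP.*-identityˡ (weight (a , b))))

  weight-split : ∀ a b → a ℕ.+ b < D → weight (a , b) ≡ weight (suc a , b) + weight (a , suc b)
  weight-split a b a+b<D = begin
    + (2 ^ (D ∸ (a ℕ.+ b)))                 ≡⟨ cong (λ k → + (2 ^ k)) (ℕP.+-∸-assoc 1 a+b<D) ⟩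
    + (2 ℕ.* 2 ^ m)                         ≡⟨ cong (λ k → + (2 ^ m ℕ.+ k)) (ℕP.+-identityʳ (2 ^ m)) ⟩
    + (2 ^ m) + + (2 ^ m)                   ≡⟨ cong (λ k → + (2 ^ m) + + (2 ^ (D ∸ k))) (ℕP.+-suc a b) ⟨
    weight (suc a , b) + weight (a , suc b) ∎
    where
    open ≡-Reasoning
    m = D ∸ suc (a ℕ.+ b)

  invariant-split : ∀ p → deg p < D → invariant (split p) ≡ 0ℤ
  invariant-split (a , b) a+b<D = begin
    invariant (split (a , b))
      ≡⟨ invariant-+ (λ i j → δ (suc a) b i j + δ a (suc b) i j) (λ i j → - δ a b i j) ⟩
    invariant (λ i j → δ (suc a) b i j + δ a (suc b) i j) + invariant (λ i j → - δ a b i j)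
      ≡⟨ cong₂ _+_ (invariant-+ (δ (suc a) b) (δ a (suc b))) (invariant-neg (δ a b)) ⟩
    invariant (δ (suc a) b) + invariant (δ a (suc b)) - invariant (δ a b)
      ≡⟨ cong₂ _-_ (cong₂ _+_ (invariant-δ (suc a) b a+b<D)
                              (invariant-δ a (suc b) (subst (_≤ D) (sym (ℕP.+-suc a b)) a+b<D)))
                   (trans (invariant-δ a b (ℕP.<⇒≤ a+b<D)) (weight-split a b a+b<D)) ⟩
    (weight (suc a , b) + weight (a , suc b)) - (weight (suc a , b) + weight (a , suc b))
      ≡⟨ ℤP.+-inverseʳ (weight (suc a , b) + weight (a , suc b)) ⟩
    0ℤ ∎
    where open ≡-Reasoning

  invariant-applyMoves : ∀ {ms} → All (MoveIn D) ms → invariant (applyMoves ms) ≡ 0ℤ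
  invariant-applyMoves [] = invariant-zero
  invariant-applyMoves {(a , b , s) ∷ ms} (a+b<D ∷ ms∈) =
    trans (invariant-+ (applyMoves ms) (moveEffect (a , b , s)))
          (cong₂ _+_ (invariant-applyMoves ms∈) (invariant-move s))
    where
    invariant-move : ∀ s → invariant (moveEffect (a , b , s)) ≡ 0ℤ
    invariant-move true  = invariant-split (a , b) a+b<D
    invariant-move false = trans (invariant-neg (split (a , b))) (cong -_ (invariant-split (a , b) a+b<D))

  invariant-outcome : ∀ {u} → Outcome D u → invariant u ≡ 0ℤ
  invariant-outcome (ms , ms∈ , u≗ms) = trans (invariant-resp u≗ms) (invariant-applyMoves ms∈)

  origin-nonpositive : ∀ {u} → Valid u → Outcome D u → ¬ (+ 0 ℤ.< u 0 0)
  origin-nonpositive {u} valid o u[0,0]>0 =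
    ℤP.<-irrefl (sym (invariant-outcome o))
      (∑ₗ-pos (weighted u) (λ {q} _ → *-nonneg (u≥0 (proj₁ q) (proj₂ q)) (ℤP.<⇒≤ (weight>0 q)))
              (∈-triangle⁺ (suc D) (s≤s z≤n)) (*-pos u[0,0]>0 (weight>0 (0 , 0))))
    where
    weight>0 : ∀ q → + 0 ℤ.< weight q
    weight>0 q = ℤ.+<+ (ℕP.m^n>0 2 (D ∸ deg q))
    u≥0 : ∀ i j → + 0 ℤ.≤ u i j
    u≥0 zero    zero    = ℤP.<⇒≤ u[0,0]>0
    u≥0 zero    (suc j) = valid 0 (suc j) (λ ())
    u≥0 (suc i) j       = valid (suc i) j (λ ())

split-corner : ∀ a b → split (a , b) (suc a) b ≡ 1ℤ
split-corner a b = cong₂ _-_ (cong₂ _+_ (δ-same (suc a) b) (δ-≢ a≢1+a)) (δ-≢ a≢1+a)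
  where
  a≢1+a : ∀ {p} → (a , p) ≢ (suc a , b)
  a≢1+a eq = ℕP.<-irrefl (cong proj₁ eq) (ℕP.n<1+n a)

split-left-vanishes : ∀ {a b a′ b′} → a′ ≤ a → (a′ , b′) ≢ (a , b) → split (a′ , b′) (suc a) b ≡ 0ℤ
split-left-vanishes {a} {b} a′≤a a′b′≢ab =
  cong₂ _-_ (cong₂ _+_ (δ-≢ (λ eq → a′b′≢ab (cong₂ _,_ (ℕP.suc-injective (cong proj₁ eq)) (cong proj₂ eq))))
                       (δ-≢ (left a′≤a)))
            (δ-≢ (left a′≤a))
  where
  left : ∀ {i j} → i ≤ a → (i , j) ≢ (suc a , b)
  left i≤a eq = ℕP.1+n≰n (subst (_≤ a) (cong proj₁ eq) i≤a)

combination : ∀ {k} → (Fin k → Point) → Vector ℤ k → Config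
combination {k} P x i j = ∑[ t < k ] (split (P t) i j * x t)

Outcome-combination : ∀ {D k} (P : Fin k → Point) x → (∀ t → deg (P t) < D) → Outcome D (combination P x)
Outcome-combination {k = zero}  P x _   = Outcome-zero
Outcome-combination {k = suc k} P x P<D =
  Outcome-resp (λ i j → cong (_+ combination (P ∘ suc) (x ∘ suc) i j) (ℤP.*-comm (split (P zero) i j) (x zero)))
    (Outcome-+ (Outcome-scale (x zero) (Outcome-split (P zero) (P<D zero)))
               (Outcome-combination (P ∘ suc) (x ∘ suc) (P<D ∘ suc)))

combination-vanishes : ∀ {B k} (P : Fin k → Point) x {i j} → (∀ t → deg (P t) < B) → B < i ℕ.+ j →
  combination P x i j ≡ 0ℤ
combination-vanishes P x {i} {j} P<B B<i+j =
  sum-zero _ (λ t → trans (cong (_* x t) (split-vanishes (P t) {i} {j} (P<B t) B<i+j)) (ℤP.*-zeroˡ (x t)))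

-- Among the splits with nonzero coefficient take one, at (a , b), with a maximal: no other
-- of them puts chips on (a + 1 , b).
combination-nonzero : ∀ {k} (P : Fin k → Point) x → (∀ {s t} → P s ≡ P t → s ≡ t) → NonTrivial x →
  ∃[ i ] ∃[ j ] ¬ (i ≡ 0 × j ≡ 0) × combination P x i j ≢ 0ℤ
combination-nonzero {k} P x P-injective (t₀ , x[t₀]≢0) =
  i⋆ , j⋆ , (λ ()) , λ eq → x[t⋆]≢0 (trans (sym value) eq)
  where
  active? = λ t → ¬? (x t ℤ.≟ 0ℤ)
  active = filter active? (allFin k)
  t⋆ = ℕExtrema.argmax (proj₁ ∘ P) t₀ active
  x[t⋆]≢0 : x t⋆ ≢ 0ℤ
  x[t⋆]≢0 = ℕExtrema.argmax-all (proj₁ ∘ P) x[t₀]≢0 (AllP.all-filter active? (allFin k))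
  maximal : ∀ t → x t ≢ 0ℤ → proj₁ (P t) ≤ proj₁ (P t⋆)
  maximal t x[t]≢0 = All.lookup (ℕExtrema.f[xs]≤f[argmax] t₀ active) (∈-filter⁺ active? (∈-allFin t) x[t]≢0)
  i⋆ = suc (proj₁ (P t⋆))
  j⋆ = proj₂ (P t⋆)
  others-vanish : ∀ t → t ≢ t⋆ → split (P t) i⋆ j⋆ * x t ≡ 0ℤ
  others-vanish t t≢t⋆ with x t ℤ.≟ 0ℤ
  ... | yes x[t]≡0 = trans (cong (split (P t) i⋆ j⋆ *_) x[t]≡0) (ℤP.*-zeroʳ (split (P t) i⋆ j⋆))
  ... | no x[t]≢0  = trans (cong (_* x t) (split-left-vanishes (maximal t x[t]≢0) (t≢t⋆ ∘ P-injective)))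
                           (ℤP.*-zeroˡ (x t))
  value : combination P x i⋆ j⋆ ≡ x t⋆
  value = trans (sum-single _ t⋆ others-vanish)
                (trans (cong (_* x t⋆) (split-corner (proj₁ (P t⋆)) (proj₂ (P t⋆)))) (ℤP.*-identityˡ (x t⋆)))

-- Decompositions of non-fundamental outcomes

toℚᵘ-toℚ : ∀ z → toℚᵘ (toℚ z) ≃ᵘ mkℚᵘ z 0
toℚᵘ-toℚ z = ℚP.toℚᵘ-fromℚᵘ (mkℚᵘ z 0)

toℚ-+ : ∀ a b → toℚ (a + b) ≡ toℚ a ℚ.+ toℚ b
toℚ-+ a b = ℚP.toℚᵘ-injective (begin
  toℚᵘ (toℚ (a + b))             ≈⟨ toℚᵘ-toℚ (a + b) ⟩
  mkℚᵘ (a + b) 0                 ≈⟨ *≡* (solve 2 (λ a b → (a :+ b) :* con 1ℤ := (a :* con 1ℤ :+ b :* con 1ℤ) :* con 1ℤ)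
                                                 refl a b) ⟩
  mkℚᵘ a 0 ℚᵘ.+ mkℚᵘ b 0         ≈⟨ ℚᵘP.+-cong (toℚᵘ-toℚ a) (toℚᵘ-toℚ b) ⟨
  toℚᵘ (toℚ a) ℚᵘ.+ toℚᵘ (toℚ b) ≈⟨ ℚP.toℚᵘ-homo-+ (toℚ a) (toℚ b) ⟨
  toℚᵘ (toℚ a ℚ.+ toℚ b)         ∎)
  where open ℚᵘP.≃-Reasoning

toℚ-/-scale : ∀ c v → toℚ v ≡ (+ 1 ℚ./ suc c) ℚ.* toℚ (+[1+ c ] * v)
toℚ-/-scale c v = ℚP.toℚᵘ-injective (begin
  toℚᵘ (toℚ v)                                        ≈⟨ toℚᵘ-toℚ v ⟩
  mkℚᵘ v 0                                            ≈⟨ *≡* cross-multiplied ⟩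
  mkℚᵘ 1ℤ c ℚᵘ.* mkℚᵘ (+[1+ c ] * v) 0                ≈⟨ ℚᵘP.*-cong (ℚP.toℚᵘ-fromℚᵘ (mkℚᵘ 1ℤ c)) (toℚᵘ-toℚ (+[1+ c ] * v)) ⟨
  toℚᵘ (+ 1 ℚ./ suc c) ℚᵘ.* toℚᵘ (toℚ (+[1+ c ] * v)) ≈⟨ ℚP.toℚᵘ-homo-* (+ 1 ℚ./ suc c) (toℚ (+[1+ c ] * v)) ⟨
  toℚᵘ ((+ 1 ℚ./ suc c) ℚ.* toℚ (+[1+ c ] * v))       ∎)
  where
  open ℚᵘP.≃-Reasoning
  cross-multiplied : v * +[1+ c ℕ.* 1 ] ≡ 1ℤ * (+[1+ c ] * v) * 1ℤ
  cross-multiplied rewrite ℕP.*-identityʳ c = solve 2 (λ v c → v :* c := con 1ℤ :* (c :* v) :* con 1ℤ) refl v +[1+ c ]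

¬Fundamental-of-sum : ∀ {D w w₁ w₂} c → + 0 ℤ.< c →
  Valid w₁ → Outcome D w₁ → SuppStrictSub w₁ w →
  Valid w₂ → Outcome D w₂ → SuppStrictSub w₂ w →
  (∀ i j → c * w i j ≡ w₁ i j + w₂ i j) → ¬ Fundamental D w
¬Fundamental-of-sum (+ zero) (ℤ.+<+ ())
¬Fundamental-of-sum {w = w} {w₁} {w₂} +[1+ c ] _ valid₁ o₁ sub₁ valid₂ o₂ sub₂ cw≡w₁+w₂ (_ , _ , _ , indecomposable) =
  indecomposable (μ , μ , w₁ , w₂ , μ>0 , μ>0 , valid₁ , o₁ , valid₂ , o₂ , sub₁ , sub₂ , λ i j → begin
    toℚ (w i j)                               ≡⟨ toℚ-/-scale c (w i j) ⟩
    μ ℚ.* toℚ (+[1+ c ] * w i j)              ≡⟨ cong (λ z → μ ℚ.* toℚ z) (cw≡w₁+w₂ i j) ⟩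
    μ ℚ.* toℚ (w₁ i j + w₂ i j)               ≡⟨ cong (μ ℚ.*_) (toℚ-+ (w₁ i j) (w₂ i j)) ⟩
    μ ℚ.* (toℚ (w₁ i j) ℚ.+ toℚ (w₂ i j))     ≡⟨ ℚP.*-distribˡ-+ μ (toℚ (w₁ i j)) (toℚ (w₂ i j)) ⟩
    μ ℚ.* toℚ (w₁ i j) ℚ.+ μ ℚ.* toℚ (w₂ i j) ∎)
  where
  open ≡-Reasoning
  μ = + 1 ℚ./ suc c
  μ>0 : 0ℚ ℚ.< μ
  μ>0 = ℚP.positive⁻¹ μ {{ℚP.normalize-pos 1 (suc c)}}

-- the quotient u / v, meaningful only for v > 0
ratio : ℤ → ℤ → ℚᵘ
ratio u v = mkℚᵘ u (ℤ.∣ v ∣ ∸ 1)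

ratio-≤⇒*-≤ : ∀ {u₁ v₁ u₂ v₂} → + 0 ℤ.< v₁ → + 0 ℤ.< v₂ → ratio u₁ v₁ ℚᵘ.≤ ratio u₂ v₂ → u₁ * v₂ ℤ.≤ u₂ * v₁
ratio-≤⇒*-≤ {v₁ = + zero} (ℤ.+<+ ())
ratio-≤⇒*-≤ {v₁ = +[1+ _ ]} {v₂ = + zero} _ (ℤ.+<+ ())
ratio-≤⇒*-≤ {v₁ = +[1+ _ ]} {v₂ = +[1+ _ ]} _ _ (ℚᵘ.*≤* u₁v₂≤u₂v₁) = u₁v₂≤u₂v₁

VanishesOff : List Point → Config → Set
VanishesOff L u = ∀ i j → (i , j) ∉ L → ¬ (i ≡ 0 × j ≡ 0) → u i j ≡ 0ℤ

VanishesOff-linear : ∀ {L u v} a b → VanishesOff L u → VanishesOff L v → VanishesOff L (λ i j → a * u i j + b * v i j)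
VanishesOff-linear a b u-vanishes v-vanishes i j ∉L ≢origin =
  trans (cong₂ (λ x y → a * x + b * y) (u-vanishes i j ∉L ≢origin) (v-vanishes i j ∉L ≢origin))
        (cong₂ _+_ (ℤP.*-zeroʳ a) (ℤP.*-zeroʳ b))

VanishesOff-nonzero⇒∈ : ∀ {L u i j} → VanishesOff L u → ¬ (i ≡ 0 × j ≡ 0) → u i j ≢ 0ℤ → (i , j) ∈ L
VanishesOff-nonzero⇒∈ {L} {i = i} {j} u-vanishes ≢origin u≢0 =
  decidable-stable ((i , j) ∈? L) (λ ∉L → u≢0 (u-vanishes i j ∉L ≢origin))

module Decomposition {D : ℕ} {w : Config} (valid : Valid w) (outcome : Outcome D w)
                     {L : List Point} (supp : ∀ i j → ((i , j) ∈ L) ⇔ (+ 0 ℤ.< w i j)) where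

  open Invariant D using (origin-nonpositive)
  module ℚᵘExtrema = Data.List.Extrema ℚᵘP.≤-totalOrder

  w>0 : ∀ {q} → q ∈ L → + 0 ℤ.< w ⟨ q ⟩
  w>0 {q} = Equivalence.to (supp (proj₁ q) (proj₂ q))

  w-vanishes : VanishesOff L w
  w-vanishes i j ∉L ≢origin =
    ℤP.≤-antisym (ℤP.≮⇒≥ (λ w>0 → ∉L (Equivalence.from (supp i j) w>0))) (valid i j ≢origin)

  Valid-intro : ∀ {u} → VanishesOff L u → (∀ {q} → q ∈ L → + 0 ℤ.≤ u ⟨ q ⟩) → Valid u
  Valid-intro u-vanishes u≥0 i j ≢origin with (i , j) ∈? L
  ... | yes ∈L = u≥0 ∈L
  ... | no ∉L  = ℤP.≤-reflexive (sym (u-vanishes i j ∉L ≢origin))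

  SuppStrictSub-intro : ∀ {u} → Valid u → Outcome D u → VanishesOff L u →
    ∀ {q} → q ∈ L → u ⟨ q ⟩ ≡ 0ℤ → SuppStrictSub u w
  SuppStrictSub-intro {u} u-valid u-outcome u-vanishes {q} q∈L u[q]≡0 =
    (λ i j u>0 → Equivalence.to (supp i j) (positive⇒∈L u>0)) ,
    proj₁ q , proj₂ q , w>0 q∈L , λ u>0 → ℤP.<-irrefl (sym u[q]≡0) u>0
    where
    positive⇒∈L : ∀ {i j} → + 0 ℤ.< u i j → (i , j) ∈ L
    positive⇒∈L {i} {j} u>0 with (i , j) ∈? L | (i ℕ.≟ 0) ×-dec (j ℕ.≟ 0)
    ... | yes ∈L | _                 = ∈L
    ... | no _   | yes (refl , refl) = ⊥-elim (origin-nonpositive u-valid u-outcome u>0)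
    ... | no ∉L  | no ≢origin        = ⊥-elim (ℤP.<-irrefl (sym (u-vanishes i j ∉L ≢origin)) u>0)

  -- r⋆ maximises v / w on L, so that c w - e v is nonnegative on L and vanishes at r⋆.
  ¬Fundamental-of-nonneg-direction : ∀ {v} → Outcome D v → VanishesOff L v → (∀ {q} → q ∈ L → + 0 ℤ.≤ v ⟨ q ⟩) →
    ∀ {p q} → p ∈ L → v ⟨ p ⟩ ≡ 0ℤ → q ∈ L → + 0 ℤ.< v ⟨ q ⟩ → ¬ Fundamental D w
  ¬Fundamental-of-nonneg-direction {v} v-outcome v-vanishes v≥0 {p} {q} p∈L v[p]≡0 q∈L v[q]>0 =
    ¬Fundamental-of-sum c c>0
      valid₁ outcome₁ (SuppStrictSub-intro valid₁ outcome₁ vanishes₁ p∈L w₁[p]≡0)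
      valid₂ outcome₂ (SuppStrictSub-intro valid₂ outcome₂ vanishes₂ r⋆∈L w₂[r⋆]≡0)
      (λ i j → solve 4 (λ c w e v → c :* w := e :* v :+ (c :* w :+ (:- e) :* v)) refl c (w i j) e (v i j))
    where
    key : Point → ℚᵘ
    key r = ratio (v ⟨ r ⟩) (w ⟨ r ⟩)
    r⋆ = ℚᵘExtrema.argmax key q L
    r⋆∈L : r⋆ ∈ L
    r⋆∈L = ℚᵘExtrema.argmax-all key q∈L (All.tabulate (λ r∈L → r∈L))
    c = v ⟨ r⋆ ⟩
    e = w ⟨ r⋆ ⟩
    maximal : ∀ {r} → r ∈ L → v ⟨ r ⟩ * e ℤ.≤ c * w ⟨ r ⟩
    maximal r∈L = ratio-≤⇒*-≤ (w>0 r∈L) (w>0 r⋆∈L) (All.lookup (ℚᵘExtrema.f[xs]≤f[argmax] {f = key} q L) r∈L)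
    c>0 : + 0 ℤ.< c
    c>0 = pos-of-*-≤ {v ⟨ q ⟩} {e} (*-pos v[q]>0 (w>0 r⋆∈L)) (maximal q∈L) (ℤP.<⇒≤ (w>0 q∈L))
    w₁ w₂ : Config
    w₁ i j = e * v i j
    w₂ i j = c * w i j + (- e) * v i j
    outcome₁ = Outcome-scale e v-outcome
    outcome₂ = Outcome-+ (Outcome-scale c outcome) (Outcome-scale (- e) v-outcome)
    vanishes₁ : VanishesOff L w₁
    vanishes₁ i j ∉L ≢origin = trans (cong (e *_) (v-vanishes i j ∉L ≢origin)) (ℤP.*-zeroʳ e)
    vanishes₂ = VanishesOff-linear c (- e) w-vanishes v-vanishes
    valid₁ = Valid-intro vanishes₁ (λ r∈L → *-nonneg (ℤP.<⇒≤ (w>0 r⋆∈L)) (v≥0 r∈L))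
    valid₂ = Valid-intro vanishes₂ (λ {r} r∈L → subst (+ 0 ℤ.≤_)
      (solve 4 (λ c w v e → c :* w :- v :* e := c :* w :+ (:- e) :* v) refl c (w ⟨ r ⟩) (v ⟨ r ⟩) e)
      (ℤP.i≤j⇒0≤j-i (maximal r∈L)))
    w₁[p]≡0 : w₁ ⟨ p ⟩ ≡ 0ℤ
    w₁[p]≡0 = trans (cong (e *_) v[p]≡0) (ℤP.*-zeroʳ e)
    w₂[r⋆]≡0 : w₂ ⟨ r⋆ ⟩ ≡ 0ℤ
    w₂[r⋆]≡0 = solve 2 (λ c e → c :* e :+ (:- e) :* c := con 0ℤ) refl c e

  -- r₀ minimises u / w on L, so that a u - b w is nonnegative on L and vanishes at r₀.
  ¬Fundamental-of-direction : ∀ {u} → Outcome D u → VanishesOff L u →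
    ∀ {p q} → p ∈ L → u ⟨ p ⟩ ≡ 0ℤ → q ∈ L → u ⟨ q ⟩ ≢ 0ℤ → ¬ Fundamental D w
  ¬Fundamental-of-direction {u} u-outcome u-vanishes {p} {q} p∈L u[p]≡0 q∈L u[q]≢0 =
    let s , s∈L , v[s]>0 = positive-point
    in ¬Fundamental-of-nonneg-direction (Outcome-+ (Outcome-scale a u-outcome) (Outcome-scale (- b) outcome))
         (VanishesOff-linear a (- b) u-vanishes w-vanishes) v≥0 r₀∈L v[r₀]≡0 s∈L v[s]>0
    where
    key : Point → ℚᵘ
    key r = ratio (u ⟨ r ⟩) (w ⟨ r ⟩)
    r₀ = ℚᵘExtrema.argmin key p L
    r₀∈L : r₀ ∈ L
    r₀∈L = ℚᵘExtrema.argmin-all key p∈L (All.tabulate (λ r∈L → r∈L))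
    a = w ⟨ r₀ ⟩
    b = u ⟨ r₀ ⟩
    minimal : ∀ {r} → r ∈ L → b * w ⟨ r ⟩ ℤ.≤ u ⟨ r ⟩ * a
    minimal r∈L = ratio-≤⇒*-≤ (w>0 r₀∈L) (w>0 r∈L) (All.lookup (ℚᵘExtrema.f[argmin]≤f[xs] {f = key} p L) r∈L)
    v : Config
    v i j = a * u i j + (- b) * w i j
    v≥0 : ∀ {r} → r ∈ L → + 0 ℤ.≤ v ⟨ r ⟩
    v≥0 {r} r∈L = subst (+ 0 ℤ.≤_)
      (solve 4 (λ u a b w → u :* a :- b :* w := a :* u :+ (:- b) :* w) refl (u ⟨ r ⟩) a b (w ⟨ r ⟩))
      (ℤP.i≤j⇒0≤j-i (minimal r∈L))
    v[r₀]≡0 : v ⟨ r₀ ⟩ ≡ 0ℤ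
    v[r₀]≡0 = solve 2 (λ a b → a :* b :+ (:- b) :* a := con 0ℤ) refl a b
    nonzero⇒positive : ∀ {s} → s ∈ L → v ⟨ s ⟩ ≢ 0ℤ → + 0 ℤ.< v ⟨ s ⟩
    nonzero⇒positive s∈L v[s]≢0 = ℤP.≤∧≢⇒< (v≥0 s∈L) (v[s]≢0 ∘ sym)
    positive-point : ∃[ s ] s ∈ L × + 0 ℤ.< v ⟨ s ⟩
    positive-point with b ℤ.≟ 0ℤ
    ... | yes b≡0 = q , q∈L , nonzero⇒positive q∈L
          (subst (_≢ 0ℤ) (sym v[q]≡a*u[q]) (*-≢0 (ℤP.<⇒≢ (w>0 r₀∈L) ∘ sym) u[q]≢0))
      where
      v[q]≡a*u[q] : v ⟨ q ⟩ ≡ a * u ⟨ q ⟩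
      v[q]≡a*u[q] = trans (cong (λ z → a * u ⟨ q ⟩ + (- z) * w ⟨ q ⟩) b≡0) (ℤP.+-identityʳ _)
    ... | no b≢0 = p , p∈L , nonzero⇒positive p∈L
          (subst (_≢ 0ℤ) (sym v[p]≡-b*w[p]) (*-≢0 (b≢0 ∘ ℤP.neg-injective) (ℤP.<⇒≢ (w>0 p∈L) ∘ sym)))
      where
      v[p]≡-b*w[p] : v ⟨ p ⟩ ≡ (- b) * w ⟨ p ⟩
      v[p]≡-b*w[p] = trans (cong (λ z → a * z + (- b) * w ⟨ p ⟩) u[p]≡0)
                           (trans (cong (_+ (- b) * w ⟨ p ⟩) (ℤP.*-zeroʳ a)) (ℤP.+-identityˡ _))

module _ {d : ℕ} {L : List Point} (L-unique : Unique L) (L-low : ∀ {q} → q ∈ L → deg q ≤ d)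
         (origin∉L : (0 , 0) ∉ L) where

  private
    P : Fin (length (triangle d)) → Point
    P = lookup (triangle d)

    Outside : Point → Set
    Outside q = q ∉ L × q ≢ (0 , 0)

    outside? : Decidable Outside
    outside? q = ¬? (q ∈? L) ×-dec ¬? (q ≟ₚ (0 , 0))

    outside : List Point
    outside = filter outside? (triangle (suc d))

    outside⁻ : ∀ {q} → q ∈ outside → q ∈ triangle (suc d) × Outside q
    outside⁻ = ∈-filter⁻ outside? {xs = triangle (suc d)}

    pieces : List Point
    pieces = (0 , 0) ∷ L ++ outside

    pieces-unique : Unique pieces
    pieces-unique = All.tabulate origin≢
      ∷ Unique.++⁺ L-unique (Unique.filter⁺ outside? (triangle-unique (suc d)))
                   (λ (q∈L , q∈outside) → proj₁ (proj₂ (outside⁻ q∈outside)) q∈L)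
      where
      origin≢ : ∀ {q} → q ∈ L ++ outside → (0 , 0) ≢ q
      origin≢ q∈ refl with ∈-++⁻ L q∈
      ... | inj₁ origin∈L       = origin∉L origin∈L
      ... | inj₂ origin∈outside = proj₂ (proj₂ (outside⁻ origin∈outside)) refl

    pieces⊆triangle : pieces ⊆ triangle (suc d)
    pieces⊆triangle (here refl) = ∈-triangle⁺ (suc d) (s≤s z≤n)
    pieces⊆triangle {q} (there q∈) with ∈-++⁻ L q∈
    ... | inj₁ q∈L       = ∈-triangle⁺ (suc d) {proj₁ q} {proj₂ q} (s≤s (L-low q∈L))
    ... | inj₂ q∈outside = proj₁ (outside⁻ q∈outside)

    few-outside : suc d < length L → suc (length outside) < length (triangle d)
    few-outside d+1<|L| = ℕP.+-cancelˡ-≤ (suc d) _ _ (begin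
      suc d ℕ.+ suc (suc |O|)       ≡⟨ ℕP.+-suc (suc d) (suc |O|) ⟩
      suc (suc d) ℕ.+ suc |O|       ≤⟨ ℕP.+-monoˡ-≤ (suc |O|) d+1<|L| ⟩
      length L ℕ.+ suc |O|          ≡⟨ ℕP.+-suc (length L) |O| ⟩
      suc (length L ℕ.+ |O|)        ≡⟨ cong suc (length-++ L) ⟨
      length pieces                 ≤⟨ Unique-⊆⇒length≤ pieces-unique pieces⊆triangle ⟩
      length (triangle (suc d))     ≡⟨ length-triangle d ⟩
      length (triangle d) ℕ.+ suc d ≡⟨ ℕP.+-comm (length (triangle d)) (suc d) ⟩
      suc d ℕ.+ length (triangle d) ∎)
      where
      open ℕP.≤-Reasoning
      |O| = length outside

    equation : Point → Vector ℤ (length (triangle d))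
    equation q t = split (P t) ⟨ q ⟩

    vanishes-off : ∀ x → All (λ q → equation q · x ≡ 0ℤ) outside → VanishesOff L (combination P x)
    vanishes-off x solves i j ∉L ≢origin with i ℕ.+ j ℕ.≤? d
    ... | yes i+j≤d = All.lookup solves (∈-filter⁺ outside? (∈-triangle⁺ (suc d) (s≤s i+j≤d))
                                          (∉L , λ eq → ≢origin (cong proj₁ eq , cong proj₂ eq)))
    ... | no i+j≰d  = combination-vanishes P x {i} {j} (λ t → ∈-triangle⁻ d (∈-lookup t)) (ℕP.≰⇒> i+j≰d)

  kernel-of-large-support : suc d < length L → ∀ p →
    ∃[ x ] NonTrivial x × VanishesOff L (combination (lookup (triangle d)) x)
                        × combination (lookup (triangle d)) x ⟨ p ⟩ ≡ 0ℤ
  kernel-of-large-support d+1<|L| p =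
    let x , x≢0 , solves = homogeneous-solution (equation p ∷ map equation outside)
          (subst (λ m → suc m < length (triangle d)) (sym (length-map equation outside)) (few-outside d+1<|L|))
    in x , x≢0 , vanishes-off x (AllP.map⁻ (All.tail solves)) , All.head solves

proposition8p4 : (D d n : ℕ) (w : Config) → Fundamental D w → Degree w d →
    SuppCard w (suc n) → n ≤ d
proposition8p4 D d n w fundamental@(valid , outcome , _) ((i₀ , j₀ , i₀+j₀≡d , w[i₀,j₀]≢0) , degree-bound)
               (L , L-unique , |L|≡1+n , supp) = ℕP.≮⇒≥ λ d<n →
  let p , p∈L = ∈-of-length≡suc |L|≡1+n
      x , x≢0 , U-vanishes , U[p]≡0 =
        kernel-of-large-support L-unique L-low origin∉L (subst (suc d <_) (sym |L|≡1+n) (s≤s d<n)) p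
      i , j , ≢origin , U[i,j]≢0 = combination-nonzero P x (lookup-injective (triangle-unique d)) x≢0
  in ¬Fundamental-of-direction (Outcome-combination P x P<D) U-vanishes
       p∈L U[p]≡0 (VanishesOff-nonzero⇒∈ U-vanishes ≢origin U[i,j]≢0) U[i,j]≢0 fundamental
  where
  open Decomposition valid outcome supp
  open Invariant D using (origin-nonpositive)
  P = lookup (triangle d)
  origin∉L : (0 , 0) ∉ L
  origin∉L origin∈L = origin-nonpositive valid outcome (Equivalence.to (supp 0 0) origin∈L)
  L-low : ∀ {q} → q ∈ L → deg q ≤ d
  L-low {q} q∈L = degree-bound (proj₁ q) (proj₂ q) (ℤP.<⇒≢ (w>0 q∈L) ∘ sym)
  d≤D : d ≤ D
  d≤D = ℕP.≮⇒≥ λ D<d → w[i₀,j₀]≢0 (Outcome-vanishes outcome (subst (D <_) (sym i₀+j₀≡d) D<d))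
  P<D : ∀ t → deg (P t) < D
  P<D t = ℕP.<-≤-trans (∈-triangle⁻ d (∈-lookup t)) d≤D
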